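{- Let $k\ge2$ and $a\in\mathbb{N}$ with $a\ge1$. For all $n\in\mathbb{N}$, \[ c^{(k)}((a.0);n)=\begin{cases}0,& 0\le n\le a;\\ 2^{\,n-a-1},& a<n<a+k-1;\\ \sum_{j=1}^{k-1}c^{(k)}((a.0);n-j),& n\ge a+k-1.\end{cases} \]
   Context: Words are over the alphabet $\mathbb{N}=\{0,1,2,\dots\}$; $(x.y)$ denotes the length-2 word with letters $x,y$. For $k\ge 2$, $\phi_k$ is the morphism of $\mathbb{N}^*$ defined for $i\in\mathbb{N}$, $0\le j\le k-1$ by $\phi_k(ki+j)=(ki)(ki+j+1)$ if $0\le j\le k-2$ and $\phi_k(ki+k-1)=ki+k$; $W_n^{(k)}=\phi_k^n(0)$. For a nonempty word $B$, $c^{(k)}(B;n)$ is the number of (possibly overlapping) occurrences of $B$ as a factor of $W_n^{(k)}$. -}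

module Defs where

open import Data.Nat using (ℕ; zero; suc; _+_; _*_; _∸_; _<?_; _≟_; NonZero)
open import Data.Nat.DivMod using (_/_; _%_)
open import Data.List using (List; []; _∷_; _++_; concatMap)
open import Relation.Nullary.Decidable using (yes; no; _×-dec_)

-- φ_k on a single letter x = k*i + j (i = x / k, j = x % k):
--   φ_k(ki+j) = (ki)(ki+j+1)   if j ≤ k-2  (i.e. j+1 < k)
--   φ_k(ki+k-1) = ki+k         otherwise
phiLetter : (k : ℕ) → .{{_ : NonZero k}} → ℕ → List ℕ
phiLetter k x with suc (x % k) <? k
... | yes _ = (k * (x / k)) ∷ (suc (k * (x / k) + x % k)) ∷ []
... | no  _ = (k * (x / k) + k) ∷ []

phi : (k : ℕ) → .{{_ : NonZero k}} → List ℕ → List ℕ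
phi k w = concatMap (phiLetter k) w

W : (k : ℕ) → .{{_ : NonZero k}} → ℕ → List ℕ
W k zero    = 0 ∷ []
W k (suc n) = phi k (W k n)

match2 : ℕ → ℕ → ℕ → ℕ → ℕ
match2 x y u v with (u ≟ x) ×-dec (v ≟ y)
... | yes _ = 1
... | no  _ = 0

count2 : ℕ → ℕ → List ℕ → ℕ
count2 x y []            = 0
count2 x y (_ ∷ [])      = 0
count2 x y (u ∷ v ∷ w)   = match2 x y u v + count2 x y (v ∷ w)

c2 : (k : ℕ) → .{{_ : NonZero k}} → ℕ → ℕ → ℕ → ℕ
c2 k x y n = count2 x y (W k n)

sumFrom1 : ℕ → (ℕ → ℕ) → ℕ
sumFrom1 zero    f = 0
sumFrom1 (suc m) f = sumFrom1 m f + f (suc m)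

{-# OPTIONS --safe #-}
-- Write k = m + 1. For j < m we have φ^{n+1}(j) = φ^n(0) φ^n(j+1), while φ^{n+1}(m) = φ^n(k)
-- only uses letters ≥ k. The last letter of φ^n(0) is n, and φ^n(j+1) starts with 0 exactly
-- when n ≥ 1 and j + 1 < m. So the count c_j(n) of (a.0) in φ^n(j) satisfies
--   c_j(n+1) = c_0(n) + [n = a and j + 1 < m] + c_{j+1}(n),   c_m(n+1) = 0,   c_j(0) = 0,
-- the middle term counting the occurrence across the seam. Unrolling in j: c_j(n) = 0 for
-- n ≤ a, c_j(a+1+r) = 2^r while j + r + 1 < m, and once the seam at n = a lies behind,
-- c_j(n) = Σ_{t=1}^{m-j} c_0(n-t).
module Submission where

open import Defs
open import Data.Nat using (ℕ; zero; suc; _+_; _*_; _∸_; _^_; _≤_; _<_; _≟_; _<?_; z≤n; s≤s; NonZero)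
open import Data.Nat.Properties
open import Data.Nat.DivMod using (_/_; _%_; m≡m%n+[m/n]*n; m%n<n; m≤n⇒m%n≡m; m<n⇒m%n≡m; m<n⇒m/n≡0; m≥n⇒m/n>0)
open import Data.Maybe using (Maybe; just; nothing; _<∣>_) renaming (map to mapMaybe)
open import Data.Maybe.Properties using (map-<∣>; <∣>-assoc; <∣>-identityʳ)
import Data.Maybe.Relation.Unary.All as AllMaybe
open import Data.Product using (_×_; _,_)
open import Data.Sum using (inj₁; inj₂)
open import Data.List using (List; []; _∷_; _++_; [_]; head; last)
open import Data.List.Properties using (concatMap-++; ++-identityʳ)
open import Data.List.Relation.Unary.All as All using (All; []; _∷_)
open import Data.List.Relation.Unary.All.Properties using (concat⁺; map⁺; head⁺)
open import Function using (_∘_)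
open import Relation.Nullary using (yes; no; contradiction)
open import Relation.Nullary.Decidable using (_×-dec_)
open import Relation.Binary.PropositionalEquality hiding ([_])
open ≡-Reasoning

last-∷ : ∀ {A : Set} (x : A) xs → last (x ∷ xs) ≡ last xs <∣> just x
last-∷ x []       = refl
last-∷ x (y ∷ ys) = begin
  last (y ∷ ys)                    ≡⟨ last-∷ y ys ⟩
  last ys <∣> just y               ≡⟨ <∣>-assoc (last ys) (just y) (just x) ⟨
  (last ys <∣> just y) <∣> just x  ≡⟨ cong (_<∣> just x) (last-∷ y ys) ⟨
  last (y ∷ ys) <∣> just x         ∎

last-++ : ∀ {A : Set} (xs ys : List A) → last (xs ++ ys) ≡ last ys <∣> last xs
last-++ []       ys = sym (<∣>-identityʳ (last ys))
last-++ (x ∷ xs) ys = begin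
  last (x ∷ xs ++ ys)               ≡⟨ last-∷ x (xs ++ ys) ⟩
  last (xs ++ ys) <∣> just x        ≡⟨ cong (_<∣> just x) (last-++ xs ys) ⟩
  (last ys <∣> last xs) <∣> just x  ≡⟨ <∣>-assoc (last ys) (last xs) (just x) ⟩
  last ys <∣> (last xs <∣> just x)  ≡⟨ cong (last ys <∣>_) (last-∷ x xs) ⟨
  last ys <∣> last (x ∷ xs)         ∎

head-++ : ∀ {A : Set} (xs ys : List A) → head (xs ++ ys) ≡ head xs <∣> head ys
head-++ []      ys = refl
head-++ (x ∷ _) ys = refl

match2-refl : ∀ x y → match2 x y x y ≡ 1
match2-refl x y with (x ≟ x) ×-dec (y ≟ y)
... | yes _ = refl
... | no ¬p = contradiction (refl , refl) ¬p

match2-≢ˡ : ∀ {x y u v} → u ≢ x → match2 x y u v ≡ 0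
match2-≢ˡ {x} {y} {u} {v} u≢x with (u ≟ x) ×-dec (v ≟ y)
... | yes (u≡x , _) = contradiction u≡x u≢x
... | no _          = refl

match2-≢ʳ : ∀ {x y u v} → v ≢ y → match2 x y u v ≡ 0
match2-≢ʳ {x} {y} {u} {v} v≢y with (u ≟ x) ×-dec (v ≟ y)
... | yes (_ , v≡y) = contradiction v≡y v≢y
... | no _          = refl

junction : ℕ → ℕ → Maybe ℕ → Maybe ℕ → ℕ
junction x y (just u) (just v) = match2 x y u v
junction x y _        _        = 0

junction-≢ˡ : ∀ {x y u} mv → u ≢ x → junction x y (just u) mv ≡ 0
junction-≢ˡ (just v) u≢x = match2-≢ˡ u≢x
junction-≢ˡ nothing  u≢x = refl

junction-≢ʳ : ∀ {x y} mu {mv} → AllMaybe.All (_≢ y) mv → junction x y mu mv ≡ 0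
junction-≢ʳ (just u) (AllMaybe.just v≢y) = match2-≢ʳ v≢y
junction-≢ʳ (just u) AllMaybe.nothing    = refl
junction-≢ʳ nothing  _                    = refl

count2-++ : ∀ x y u v →
  count2 x y (u ++ v) ≡ count2 x y u + junction x y (last u) (head v) + count2 x y v
count2-++ x y []          v       = refl
count2-++ x y (p ∷ [])    []      = refl
count2-++ x y (p ∷ [])    (q ∷ v) = refl
count2-++ x y (p ∷ q ∷ u) v       = begin
  pq + count2 x y (q ∷ u ++ v)                      ≡⟨ cong (pq +_) (count2-++ x y (q ∷ u) v) ⟩
  pq + (count2 x y (q ∷ u) + mid + count2 x y v)    ≡⟨ +-assoc pq _ _ ⟨
  pq + (count2 x y (q ∷ u) + mid) + count2 x y v    ≡⟨ cong (_+ count2 x y v) (+-assoc pq _ mid) ⟨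
  pq + count2 x y (q ∷ u) + mid + count2 x y v      ∎
  where
  pq mid : ℕ
  pq  = match2 x y p q
  mid = junction x y (last (q ∷ u)) (head v)

All≢⇒count2≡0 : ∀ x y w → All (_≢ y) w → count2 x y w ≡ 0
All≢⇒count2≡0 x y []          _               = refl
All≢⇒count2≡0 x y (u ∷ [])    _               = refl
All≢⇒count2≡0 x y (u ∷ v ∷ w) (_ ∷ v≢y ∷ w≢y) =
  cong₂ _+_ (match2-≢ʳ v≢y) (All≢⇒count2≡0 x y (v ∷ w) (v≢y ∷ w≢y))

sumFrom1-shift : ∀ s f → sumFrom1 (suc s) f ≡ f 1 + sumFrom1 s (f ∘ suc)
sumFrom1-shift zero    f = sym (+-identityʳ (f 1))
sumFrom1-shift (suc s) f = begin
  sumFrom1 (suc s) f + f (2 + s)                  ≡⟨ cong (_+ f (2 + s)) (sumFrom1-shift s f) ⟩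
  f 1 + sumFrom1 s (f ∘ suc) + f (2 + s)          ≡⟨ +-assoc (f 1) _ _ ⟩
  f 1 + (sumFrom1 s (f ∘ suc) + f (2 + s))        ∎

sumFrom1-cong : ∀ s {f g} → f ≗ g → sumFrom1 s f ≡ sumFrom1 s g
sumFrom1-cong zero    f≗g = refl
sumFrom1-cong (suc s) f≗g = cong₂ _+_ (sumFrom1-cong s f≗g) (f≗g (suc s))

module _ (k : ℕ) .{{_ : NonZero k}} where

  phi^ : ℕ → List ℕ → List ℕ
  phi^ zero    w = w
  phi^ (suc n) w = phi k (phi^ n w)

  W≡phi^ : ∀ n → W k n ≡ phi^ n [ 0 ]
  W≡phi^ zero    = refl
  W≡phi^ (suc n) = cong (phi k) (W≡phi^ n)

  phi^-suc : ∀ n w → phi^ (suc n) w ≡ phi^ n (phi k w)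
  phi^-suc zero    w = refl
  phi^-suc (suc n) w = cong (phi k) (phi^-suc n w)

  phi^-++ : ∀ n u v → phi^ n (u ++ v) ≡ phi^ n u ++ phi^ n v
  phi^-++ zero    u v = refl
  phi^-++ (suc n) u v = begin
    phi k (phi^ n (u ++ v))              ≡⟨ cong (phi k) (phi^-++ n u v) ⟩
    phi k (phi^ n u ++ phi^ n v)         ≡⟨ concatMap-++ (phiLetter k) (phi^ n u) (phi^ n v) ⟩
    phi k (phi^ n u) ++ phi k (phi^ n v) ∎

  k[x/k]+x%k≡x : ∀ x → k * (x / k) + x % k ≡ x
  k[x/k]+x%k≡x x = begin
    k * (x / k) + x % k  ≡⟨ +-comm (k * (x / k)) (x % k) ⟩
    x % k + k * (x / k)  ≡⟨ cong (x % k +_) (*-comm k (x / k)) ⟩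
    x % k + x / k * k    ≡⟨ m≡m%n+[m/n]*n x k ⟨
    x                    ∎

  last-phiLetter : ∀ x → last (phiLetter k x) ≡ just (suc x)
  last-phiLetter x with suc (x % k) <? k
  ... | yes _ = cong (just ∘ suc) (k[x/k]+x%k≡x x)
  ... | no ¬p = cong just (begin
    k * (x / k) + k            ≡⟨ cong (k * (x / k) +_) (≤-antisym (m%n<n x k) (≮⇒≥ ¬p)) ⟨
    k * (x / k) + suc (x % k)  ≡⟨ +-suc (k * (x / k)) (x % k) ⟩
    suc (k * (x / k) + x % k)  ≡⟨ cong suc (k[x/k]+x%k≡x x) ⟩
    suc x                      ∎)

  last-phi : ∀ w → last (phi k w) ≡ mapMaybe suc (last w)
  last-phi []      = refl
  last-phi (x ∷ w) = begin
    last (phiLetter k x ++ phi k w)                  ≡⟨ last-++ (phiLetter k x) (phi k w) ⟩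
    last (phi k w) <∣> last (phiLetter k x)          ≡⟨ cong₂ _<∣>_ (last-phi w) (last-phiLetter x) ⟩
    mapMaybe suc (last w) <∣> mapMaybe suc (just x)  ≡⟨ map-<∣> suc (last w) (just x) ⟨
    mapMaybe suc (last w <∣> just x)                 ≡⟨ cong (mapMaybe suc) (last-∷ x w) ⟨
    mapMaybe suc (last (x ∷ w))                      ∎

  last-phi^ : ∀ n x → last (phi^ n [ x ]) ≡ just (n + x)
  last-phi^ zero    x = refl
  last-phi^ (suc n) x = trans (last-phi (phi^ n [ x ])) (cong (mapMaybe suc) (last-phi^ n x))

  phiLetter-≥ : ∀ {x} → k ≤ x → All (k ≤_) (phiLetter k x)
  phiLetter-≥ {x} k≤x with suc (x % k) <? k
  ... | yes _ = k≤k[x/k] ∷ ≤-trans k≤k[x/k] (m≤n⇒m≤1+n (m≤m+n (k * (x / k)) (x % k))) ∷ []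
    where
    k≤k[x/k] : k ≤ k * (x / k)
    k≤k[x/k] = subst (_≤ k * (x / k)) (*-identityʳ k) (*-monoʳ-≤ k (m≥n⇒m/n>0 k≤x))
  ... | no _  = m≤n+m k (k * (x / k)) ∷ []

  phi^-≥ : ∀ n {w} → All (k ≤_) w → All (k ≤_) (phi^ n w)
  phi^-≥ zero    k≤w = k≤w
  phi^-≥ (suc n) k≤w = concat⁺ (map⁺ (All.map phiLetter-≥ (phi^-≥ n k≤w)))

phiLetter-< : ∀ {m j} → j < m → phiLetter (suc m) j ≡ 0 ∷ suc j ∷ []
phiLetter-< {m} {j} j<m with suc (j % suc m) <? suc m
... | yes _ rewrite m≤n⇒m%n≡m (<⇒≤ j<m) | m<n⇒m/n≡0 (m<n⇒m<1+n j<m) | *-zeroʳ m = refl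
... | no ¬p = contradiction (subst (λ i → suc i < suc m) (sym (m≤n⇒m%n≡m (<⇒≤ j<m))) (s≤s j<m)) ¬p

phiLetter-top : ∀ m → phiLetter (suc m) m ≡ [ suc m ]
phiLetter-top m with suc (m % suc m) <? suc m
... | yes p rewrite m<n⇒m%n≡m (n<1+n m) = contradiction p (<-irrefl refl)
... | no _  rewrite m<n⇒m/n≡0 (n<1+n m) | *-zeroʳ m = refl

phi^-split : ∀ {m j} n → j < m →
  phi^ (suc m) (suc n) [ j ] ≡ phi^ (suc m) n [ 0 ] ++ phi^ (suc m) n [ suc j ]
phi^-split {m} {j} n j<m = begin
  phi^ (suc m) (suc n) [ j ]                        ≡⟨ phi^-suc (suc m) n [ j ] ⟩
  phi^ (suc m) n (phiLetter (suc m) j ++ [])        ≡⟨ cong (phi^ (suc m) n) (++-identityʳ _) ⟩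
  phi^ (suc m) n (phiLetter (suc m) j)              ≡⟨ cong (phi^ (suc m) n) (phiLetter-< j<m) ⟩
  phi^ (suc m) n ([ 0 ] ++ [ suc j ])               ≡⟨ phi^-++ (suc m) n [ 0 ] [ suc j ] ⟩
  phi^ (suc m) n [ 0 ] ++ phi^ (suc m) n [ suc j ]  ∎

phi^-top : ∀ m n → phi^ (suc m) (suc n) [ m ] ≡ phi^ (suc m) n [ suc m ]
phi^-top m n = trans (phi^-suc (suc m) n [ m ])
                     (cong (phi^ (suc m) n) (trans (++-identityʳ _) (phiLetter-top m)))

head-phi^ : ∀ {m j} n → j < m → head (phi^ (suc m) (suc n) [ j ]) ≡ just 0
head-phi^ {m} {j} n j<m = begin
  head (phi^ (suc m) (suc n) [ j ])                                 ≡⟨ cong head (phi^-split n j<m) ⟩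
  head (phi^ (suc m) n [ 0 ] ++ phi^ (suc m) n [ suc j ])           ≡⟨ head-++ (phi^ (suc m) n [ 0 ]) _ ⟩
  head (phi^ (suc m) n [ 0 ]) <∣> head (phi^ (suc m) n [ suc j ])  ≡⟨ cong (_<∣> head (phi^ (suc m) n [ suc j ])) (head-phi^-0 n) ⟩
  just 0                                                            ∎
  where
  head-phi^-0 : ∀ n → head (phi^ (suc m) n [ 0 ]) ≡ just 0
  head-phi^-0 zero    = refl
  head-phi^-0 (suc n) = head-phi^ n (≤-trans (s≤s z≤n) j<m)

module Counts (m a : ℕ) where

  c : ℕ → ℕ → ℕ
  c j n = count2 a 0 (phi^ (suc m) n [ j ])

  seam : ℕ → ℕ → ℕ
  seam j n = junction a 0 (just n) (head (phi^ (suc m) n [ suc j ]))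

  c-step : ∀ {j} n → j < m → c j (suc n) ≡ c 0 n + seam j n + c (suc j) n
  c-step {j} n j<m = begin
    c j (suc n)                                                     ≡⟨ cong (count2 a 0) (phi^-split n j<m) ⟩
    count2 a 0 (phi^ (suc m) n [ 0 ] ++ phi^ (suc m) n [ suc j ])  ≡⟨ count2-++ a 0 (phi^ (suc m) n [ 0 ]) _ ⟩
    c 0 n + junction a 0 (last (phi^ (suc m) n [ 0 ])) hd + c (suc j) n
      ≡⟨ cong (λ l → c 0 n + junction a 0 l hd + c (suc j) n) last≡n ⟩
    c 0 n + seam j n + c (suc j) n                                  ∎
    where
    hd : Maybe ℕ
    hd = head (phi^ (suc m) n [ suc j ])
    last≡n : last (phi^ (suc m) n [ 0 ]) ≡ just n
    last≡n = trans (last-phi^ (suc m) n 0) (cong just (+-identityʳ n))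

  ≥k⇒≢0 : ∀ {v} → suc m ≤ v → v ≢ 0
  ≥k⇒≢0 k≤v = >⇒≢ (≤-trans (s≤s z≤n) k≤v)

  c-top : ∀ n → c m (suc n) ≡ 0
  c-top n = begin
    c m (suc n)                           ≡⟨ cong (count2 a 0) (phi^-top m n) ⟩
    count2 a 0 (phi^ (suc m) n [ suc m ]) ≡⟨ All≢⇒count2≡0 a 0 _ (All.map ≥k⇒≢0 (phi^-≥ (suc m) n (≤-refl ∷ []))) ⟩
    0                                     ∎

  seam-≢ : ∀ {j n} → n ≢ a → seam j n ≡ 0
  seam-≢ {j} {n} n≢a = junction-≢ˡ (head (phi^ (suc m) n [ suc j ])) n≢a

  seam-top : ∀ {j} n → suc j ≡ m → seam j n ≡ 0
  seam-top zero    1+j≡m = match2-≢ʳ (λ ())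
  seam-top (suc n) 1+j≡m rewrite 1+j≡m | phi^-top m n =
    junction-≢ʳ (just (suc n)) (AllMaybe.map ≥k⇒≢0 (head⁺ (phi^-≥ (suc m) n (≤-refl ∷ []))))

  seam-a : ∀ {j} → 1 ≤ a → suc j < m → seam j a ≡ 1
  seam-a {j} (s≤s {n = a′} z≤n) 1+j<m rewrite head-phi^ a′ 1+j<m = match2-refl a 0

  c-below : ∀ {j n} → n ≤ a → j ≤ m → c j n ≡ 0
  c-below {j} {zero}  _    _   = refl
  c-below {j} {suc n} n<a j≤m with m≤n⇒m<n∨m≡n j≤m
  ... | inj₂ refl = c-top n
  ... | inj₁ j<m  = begin
    c j (suc n)                     ≡⟨ c-step n j<m ⟩
    c 0 n + seam j n + c (suc j) n  ≡⟨ cong₂ _+_ (cong₂ _+_ (c-below n≤a z≤n) (seam-≢ (<⇒≢ n<a))) (c-below n≤a j<m) ⟩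
    0                               ∎
    where
    n≤a : n ≤ a
    n≤a = <⇒≤ n<a

  c-doubling : ∀ {j} r → 1 ≤ a → suc (j + r) < m → c j (r + suc a) ≡ 2 ^ r
  c-doubling {j} zero    1≤a bound = begin
    c j (suc a)                     ≡⟨ c-step a j<m ⟩
    c 0 a + seam j a + c (suc j) a  ≡⟨ cong₂ _+_ (cong₂ _+_ (c-below ≤-refl z≤n) (seam-a 1≤a 1+j<m)) (c-below ≤-refl (<⇒≤ 1+j<m)) ⟩
    1                               ∎
    where
    1+j<m : suc j < m
    1+j<m = subst (λ i → suc i < m) (+-identityʳ j) bound
    j<m : j < m
    j<m = <-trans (n<1+n j) 1+j<m
  c-doubling {j} (suc r) 1≤a bound = begin
    c j (suc n)                                 ≡⟨ c-step n (m+n≤o⇒m≤o (suc j) (<⇒≤ bound)) ⟩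
    c 0 n + seam j n + c (suc j) n              ≡⟨ cong₂ _+_ (cong₂ _+_ (c-doubling r 1≤a 1+r<m) (seam-≢ (>⇒≢ (m≤n+m (suc a) r))))
                                                             (c-doubling r 1≤a (subst (λ i → suc i < m) (+-suc j r) bound)) ⟩
    2 ^ r + 0 + 2 ^ r                           ≡⟨ cong (_+ 2 ^ r) (+-identityʳ (2 ^ r)) ⟩
    2 ^ r + 2 ^ r                               ≡⟨ cong (2 ^ r +_) (+-identityʳ (2 ^ r)) ⟨
    2 ^ suc r                                   ∎
    where
    n : ℕ
    n = r + suc a
    1+r<m : suc r < m
    1+r<m = ≤-trans (s≤s (m≤n+m (suc r) j)) (<⇒≤ bound)

  seam-beyond : ∀ s {j n} → j + suc s ≡ m → s + a ≤ n → seam j n ≡ 0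
  seam-beyond zero    {j} {n} j+1≡m _   = seam-top n (trans (+-comm 1 j) j+1≡m)
  seam-beyond (suc s)         _     a<n = seam-≢ (>⇒≢ (≤-trans (s≤s (m≤n+m a s)) a<n))

  c-sum : ∀ s {j n} → j + s ≡ m → s + a ≤ n → c j n ≡ sumFrom1 s (λ t → c 0 (n ∸ t))
  c-sum zero    {j} {zero}  _     _ = refl
  c-sum zero    {j} {suc n} j+0≡m _ rewrite +-identityʳ j | j+0≡m = c-top n
  c-sum (suc s) {j} {suc n} j+1+s≡m (s≤s s+a≤n) = begin
    c j (suc n)                                        ≡⟨ c-step n j<m ⟩
    c 0 n + seam j n + c (suc j) n                     ≡⟨ cong₂ _+_ (cong (c 0 n +_) (seam-beyond s j+1+s≡m s+a≤n))
                                                                     (c-sum s (trans (sym (+-suc j s)) j+1+s≡m) s+a≤n) ⟩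
    c 0 n + 0 + sumFrom1 s (λ t → c 0 (n ∸ t))         ≡⟨ cong (_+ sumFrom1 s (λ t → c 0 (n ∸ t))) (+-identityʳ (c 0 n)) ⟩
    c 0 n + sumFrom1 s (λ t → c 0 (n ∸ t))             ≡⟨ sumFrom1-shift s (λ t → c 0 (suc n ∸ t)) ⟨
    sumFrom1 (suc s) (λ t → c 0 (suc n ∸ t))           ∎
    where
    j<m : j < m
    j<m = subst (j <_) j+1+s≡m (m<m+n j (s≤s z≤n))

lemma5p8 : (k a : ℕ) → .{{_ : NonZero k}} → 2 ≤ k → 1 ≤ a →
    (∀ n → n ≤ a → c2 k a 0 n ≡ 0) ×
    (∀ n → a < n → n < a + k ∸ 1 → c2 k a 0 n ≡ 2 ^ (n ∸ a ∸ 1)) ×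
    (∀ n → a + k ∸ 1 ≤ n → c2 k a 0 n ≡ sumFrom1 (k ∸ 1) (λ j → c2 k a 0 (n ∸ j)))
lemma5p8 .(2 + l) a (s≤s (s≤s {n = l} z≤n)) 1≤a = below , doubling , recurrence
  where
  open Counts (suc l) a

  c2≗c0 : c2 (2 + l) a 0 ≗ c 0
  c2≗c0 n = cong (count2 a 0) (W≡phi^ (2 + l) n)

  a+k∸1≡m+a : a + (2 + l) ∸ 1 ≡ suc l + a
  a+k∸1≡m+a = trans (cong (_∸ 1) (+-suc a (suc l))) (+-comm a (suc l))

  below : ∀ n → n ≤ a → c2 (2 + l) a 0 n ≡ 0
  below n n≤a = trans (c2≗c0 n) (c-below n≤a z≤n)

  doubling : ∀ n → a < n → n < a + (2 + l) ∸ 1 → c2 (2 + l) a 0 n ≡ 2 ^ (n ∸ a ∸ 1)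
  doubling n a<n n<a+k∸1 = begin
    c2 (2 + l) a 0 n   ≡⟨ c2≗c0 n ⟩
    c 0 n              ≡⟨ cong (c 0) r+1+a≡n ⟨
    c 0 (r + suc a)    ≡⟨ c-doubling r 1≤a (+-cancelʳ-< a (suc r) (suc l) r+1+a<m+a) ⟩
    2 ^ r              ≡⟨ cong (2 ^_) (trans (∸-+-assoc n a 1) (cong (n ∸_) (+-comm a 1))) ⟨
    2 ^ (n ∸ a ∸ 1)    ∎
    where
    r : ℕ
    r = n ∸ suc a
    r+1+a≡n : r + suc a ≡ n
    r+1+a≡n = m∸n+n≡m a<n
    r+1+a<m+a : suc r + a < suc l + a
    r+1+a<m+a = subst₂ _<_ (trans (sym r+1+a≡n) (+-suc r a)) a+k∸1≡m+a n<a+k∸1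

  recurrence : ∀ n → a + (2 + l) ∸ 1 ≤ n →
    c2 (2 + l) a 0 n ≡ sumFrom1 (suc l) (λ j → c2 (2 + l) a 0 (n ∸ j))
  recurrence n a+k∸1≤n = begin
    c2 (2 + l) a 0 n                            ≡⟨ c2≗c0 n ⟩
    c 0 n                                       ≡⟨ c-sum (suc l) refl (subst (_≤ n) a+k∸1≡m+a a+k∸1≤n) ⟩
    sumFrom1 (suc l) (λ j → c 0 (n ∸ j))       ≡⟨ sumFrom1-cong (suc l) (λ j → c2≗c0 (n ∸ j)) ⟨
    sumFrom1 (suc l) (λ j → c2 (2 + l) a 0 (n ∸ j)) ∎
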